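{- Let $B$ be a set. The scheme "for every predicate $T$ on $B^*$, if $T$ is a spread then $T$ has an infinite branch" is equivalent to the scheme "for every predicate $T$ on $B^*$, if $T$ is productive then $T$ has an infinite branch". Likewise, the scheme "for every predicate $T$ on $B^*$, if $T$ is barred then $T$ is barricaded" is equivalent to the scheme "for every predicate $T$ on $B^*$, if $T$ is barred then $T$ is inductively barred".
   Context: $B^*$ is the set of finite sequences over $B$, with empty sequence $\langle\rangle$ and $u\star b$ the extension of $u$ by $b$. For $\alpha:\mathbb{N}\to B$, $u\prec_s\alpha$ means $u(i)=\alpha(i)$ for all $i<|u|$. $T$ is progressing if $\forall u\,(u\in T\Rightarrow\exists b\,u\star b\in T)$; hereditary if $\forall u\,((\forall b\,u\star b\in T)\Rightarrow u\in T)$. The pruning of $T$ is the greatest $X$ with $X(u)\Rightarrow(u\in T\wedge\exists b\,X(u\star b))$; the hereditary closure of $T$ is the least $X$ with $X(u)$ whenever $u\in T$ or $\forall b\,X(u\star b)$. $T$ is a spread if $\langle\rangle\in T$ and $T$ is progressing; productive if $\langle\rangle$ is in the pruning of $T$; barricaded if ($T$ hereditary implies $\langle\rangle\in T$); inductively barred if $\langle\rangle$ is in the hereditary closure of $T$. $T$ has an infinite branch if $\exists\alpha:\mathbb{N}\to B\,\forall u\,(u\prec_s\alpha\Rightarrow u\in T)$; $T$ is barred if $\forall\alpha:\mathbb{N}\to B\,\exists u\,(u\prec_s\alpha\wedge u\in T)$. -}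

module Defs where

open import Level using (Level; suc)
open import Data.Nat using (ℕ)
open import Data.Fin using (Fin; toℕ)
open import Data.List using (List; []; length; lookup; _∷ʳ_)
open import Data.Product using (Σ; _×_)
open import Relation.Binary.PropositionalEquality using (_≡_)

module _ {ℓ : Level} {B : Set ℓ} where

  _⋆_ : List B → B → List B
  u ⋆ b = u ∷ʳ b

  _≺ₛ_ : List B → (ℕ → B) → Set ℓ
  u ≺ₛ α = (i : Fin (length u)) → lookup u i ≡ α (toℕ i)

  Progressing : (List B → Set ℓ) → Set ℓ
  Progressing T = ∀ u → T u → Σ B λ b → T (u ⋆ b)

  Hereditary : (List B → Set ℓ) → Set ℓ
  Hereditary T = ∀ u → (∀ b → T (u ⋆ b)) → T u

  PruningPostFixed : (List B → Set ℓ) → (List B → Set ℓ) → Set ℓ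
  PruningPostFixed T X = ∀ u → X u → T u × Σ B λ b → X (u ⋆ b)

  -- the pruning of T: the greatest X with X u → (T u ∧ ∃ b. X (u ⋆ b)),
  -- i.e. the union of all such post-fixed points (Knaster–Tarski)
  Pruning : (List B → Set ℓ) → List B → Set (suc ℓ)
  Pruning T u = Σ (List B → Set ℓ) λ X → PruningPostFixed T X × X u

  data HerClosure (T : List B → Set ℓ) : List B → Set ℓ where
    base : ∀ {u} → T u → HerClosure T u
    step : ∀ {u} → (∀ b → HerClosure T (u ⋆ b)) → HerClosure T u

  Spread : (List B → Set ℓ) → Set ℓ
  Spread T = T [] × Progressing T

  Productive : (List B → Set ℓ) → Set (suc ℓ)
  Productive T = Pruning T []

  Barricaded : (List B → Set ℓ) → Set ℓ
  Barricaded T = Hereditary T → T []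

  InductivelyBarred : (List B → Set ℓ) → Set ℓ
  InductivelyBarred T = HerClosure T []

  HasInfiniteBranch : (List B → Set ℓ) → Set ℓ
  HasInfiniteBranch T = Σ (ℕ → B) λ α → ∀ u → u ≺ₛ α → T u

  Barred : (List B → Set ℓ) → Set ℓ
  Barred T = (α : ℕ → B) → Σ (List B) λ u → u ≺ₛ α × T u

module Submission where

open import Defs
open import Level using (Level)
open import Data.List using (List; [])
open import Data.Product using (_×_; _,_; proj₁; proj₂)
open import Function.Bundles using (_⇔_; mk⇔)

module _ {ℓ : Level} {B : Set ℓ} where

  _⊆_ : (List B → Set ℓ) → (List B → Set ℓ) → Set ℓ
  X ⊆ T = ∀ u → X u → T u

  hasInfiniteBranch-mono : (X T : List B → Set ℓ) →
    X ⊆ T → HasInfiniteBranch X → HasInfiniteBranch T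
  hasInfiniteBranch-mono X T X⊆T (α , onα) = α , λ u u≺α → X⊆T u (onα u u≺α)

  barred-mono : (X T : List B → Set ℓ) → X ⊆ T → Barred X → Barred T
  barred-mono X T X⊆T barred α with barred α
  ... | u , u≺α , Xu = u , u≺α , X⊆T u Xu

  spread⇒productive : (T : List B → Set ℓ) → Spread T → Productive T
  spread⇒productive T (T[] , progressing) =
    T , (λ u Tu → Tu , progressing u Tu) , T[]

  postFixed⊆ : (T X : List B → Set ℓ) → PruningPostFixed T X → X ⊆ T
  postFixed⊆ T X postFixed u Xu = proj₁ (postFixed u Xu)

  postFixed⇒progressing : (T X : List B → Set ℓ) → PruningPostFixed T X → Progressing X
  postFixed⇒progressing T X postFixed u Xu = proj₂ (postFixed u Xu)

  herClosure-hereditary : (T : List B → Set ℓ) → Hereditary (HerClosure T)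
  herClosure-hereditary T u allSuccessors = step allSuccessors

  herClosure-least : (T : List B → Set ℓ) → Hereditary T → HerClosure T ⊆ T
  herClosure-least T hereditary u (base Tu) = Tu
  herClosure-least T hereditary u (step f) =
    hereditary u (λ b → herClosure-least T hereditary _ (f b))

  inductivelyBarred⇒barricaded : (T : List B → Set ℓ) → InductivelyBarred T → Barricaded T
  inductivelyBarred⇒barricaded T indBarred hereditary =
    herClosure-least T hereditary [] indBarred

  -- The post-fixed point X witnessing productivity of T is a spread inside T.
  spreadScheme⇒productiveScheme :
    ((T : List B → Set ℓ) → Spread T → HasInfiniteBranch T) →
    ((T : List B → Set ℓ) → Productive T → HasInfiniteBranch T)
  spreadScheme⇒productiveScheme spreadScheme T (X , postFixed , X[]) =
    hasInfiniteBranch-mono X T (postFixed⊆ T X postFixed)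
      (spreadScheme X (X[] , postFixed⇒progressing T X postFixed))

  productiveScheme⇒spreadScheme :
    ((T : List B → Set ℓ) → Productive T → HasInfiniteBranch T) →
    ((T : List B → Set ℓ) → Spread T → HasInfiniteBranch T)
  productiveScheme⇒spreadScheme productiveScheme T spread =
    productiveScheme T (spread⇒productive T spread)

  -- Apply the hypothesis to HerClosure T, which is barred (it contains T) and hereditary.
  barricadedScheme⇒inductiveScheme :
    ((T : List B → Set ℓ) → Barred T → Barricaded T) →
    ((T : List B → Set ℓ) → Barred T → InductivelyBarred T)
  barricadedScheme⇒inductiveScheme barricadedScheme T barred =
    barricadedScheme (HerClosure T) (barred-mono T (HerClosure T) (λ _ → base) barred)
      (herClosure-hereditary T)

  inductiveScheme⇒barricadedScheme :
    ((T : List B → Set ℓ) → Barred T → InductivelyBarred T) →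
    ((T : List B → Set ℓ) → Barred T → Barricaded T)
  inductiveScheme⇒barricadedScheme inductiveScheme T barred =
    inductivelyBarred⇒barricaded T (inductiveScheme T barred)

theorem1 : ∀ {ℓ : Level} (B : Set ℓ) →
    (((T : List B → Set ℓ) → Spread T → HasInfiniteBranch T)
    ⇔ ((T : List B → Set ℓ) → Productive T → HasInfiniteBranch T))
    × (((T : List B → Set ℓ) → Barred T → Barricaded T)
    ⇔ ((T : List B → Set ℓ) → Barred T → InductivelyBarred T))
theorem1 B =
  mk⇔ spreadScheme⇒productiveScheme productiveScheme⇒spreadScheme
  , mk⇔ barricadedScheme⇒inductiveScheme inductiveScheme⇒barricadedScheme
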